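{- Let $G'$ and $G$ be digraphs on the same set of $n$ nodes with the same transitive closure $G^*$, where $G'$ has independence number $\alpha$ and the independence number of $G$ is at least that of $G'$. Then $G$ contains a subgraph $H$ with arboricity at most $\alpha+2$ whose transitive closure equals $G^*$.
   Context: All digraphs are simple. The independence number and the arboricity of a digraph are those of its underlying undirected graph. The transitive closure of a digraph $G=(V,A)$ is the digraph on $V$ having an arc $(u,v)$ iff there is a directed path from $u$ to $v$ in $G$. -}

module Defs where

open import Data.Nat using (ℕ; zero; suc; _+_; _≤_)
open import Data.Fin using (Fin; zero; suc; inject₁; fromℕ)
open import Data.Fin.Subset using (Subset; _∈_; ∣_∣)
open import Data.Bool using (Bool; true; false)
open import Data.Product using (Σ; ∃; _×_; _,_)
open import Data.Sum using (_⊎_)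
open import Relation.Nullary using (¬_)
open import Relation.Binary.PropositionalEquality using (_≡_; _≢_)
open import Relation.Binary.Construct.Closure.Transitive using (TransClosure)
open import Function.Definitions using (Injective)

-- Multiple arcs cannot occur; the two
-- opposite arcs (u,v) and (v,u) may both be present.
record Digraph (n : ℕ) : Set where
  field
    adj      : Fin n → Fin n → Bool
    loopless : ∀ v → adj v v ≡ false

open Digraph public

Arc : ∀ {n} → Digraph n → Fin n → Fin n → Set
Arc G u v = adj G u v ≡ true

Reach : ∀ {n} → Digraph n → Fin n → Fin n → Set
Reach G = TransClosure (Arc G)

ClosureArc : ∀ {n} → Digraph n → Fin n → Fin n → Set
ClosureArc G u v = u ≢ v × Reach G u v

SameClosure : ∀ {n} → Digraph n → Digraph n → Set
SameClosure G H = ∀ u v → (ClosureArc G u v → ClosureArc H u v)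
                        × (ClosureArc H u v → ClosureArc G u v)

Subgraph : ∀ {n} → Digraph n → Digraph n → Set
Subgraph H G = ∀ u v → Arc H u v → Arc G u v

Edge : ∀ {n} → Digraph n → Fin n → Fin n → Set
Edge G u v = Arc G u v ⊎ Arc G v u

Independent : ∀ {n} → Digraph n → Subset n → Set
Independent G S = ∀ u v → u ∈ S → v ∈ S → ¬ Edge G u v

IsIndependenceNumber : ∀ {n} → Digraph n → ℕ → Set
IsIndependenceNumber G α =
  (Σ (Subset _) λ S → Independent G S × ∣ S ∣ ≡ α)
  × (∀ S → Independent G S → ∣ S ∣ ≤ α)

-- a cycle (of length ≥ 3, on distinct vertices) in an undirected edge relation E
HasCycle : ∀ {n} → (Fin n → Fin n → Set) → Set
HasCycle {n} E =
  Σ ℕ λ m → Σ (Fin (suc (suc (suc m))) → Fin n) λ f →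
    Injective _≡_ _≡_ f
    × (∀ (i : Fin (suc (suc m))) → E (f (inject₁ i)) (f (suc i)))
    × E (f (fromℕ (suc (suc m)))) (f zero)

Forest : ∀ {n} → (Fin n → Fin n → Set) → Set
Forest E = ¬ HasCycle E

-- arboricity ≤ k: the edges of the underlying graph can be partitioned into
-- k forests, i.e. there is a (symmetric) k-colouring of the edges in which
-- every colour class is a forest
ArboricityAtMost : ∀ {n} → Digraph n → ℕ → Set
ArboricityAtMost {n} G k =
  Σ (Fin n → Fin n → Fin k) λ c →
    (∀ u v → c u v ≡ c v u)
    × (∀ (i : Fin k) → Forest (λ u v → Edge G u v × c u v ≡ i))

-- Within every strong component of G, a breadth-first out-branching and in-branching rooted at
-- the least vertex of the component are two forests that keep the component strongly connected.
-- Between components it suffices to keep covering arcs x → y of the condensation (no strong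
-- component lies strictly between those of x and y), and of these only one per head y and
-- component of the tail, namely the one with the least tail. The tails of the kept arcs into y
-- are pairwise unreachable from each other, hence independent in G′, which has the same closure:
-- there are at most α of them. Colouring a kept arc by the rank of its tail among them, every
-- vertex has at most one parent in each colour class and a parent has fewer ancestors than its
-- child, so each class is a forest; the two kinds of branchings take the remaining two colours.
module Submission where

open import Defs
open import Data.Nat using (ℕ; _≤_; _+_; zero; suc; pred; _<_; z≤n; s≤s; s≤s⁻¹)
open import Data.Product using (Σ; _×_; ∃; ∃₂; _,_; proj₁; proj₂)

open import Level using (0ℓ)
open import Data.Bool using (true)
open import Data.Bool.Properties using () renaming (_≟_ to _≟ᵇ_)
open import Data.Empty using (⊥)
open import Data.Fin as Fin using (Fin; zero; suc; toℕ; fromℕ<; inject₁; join; splitAt)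
import Data.Fin.Properties as Finₚ
open import Data.Fin.Subset using (Subset; ∣_∣) renaming (_∈_ to _∈ₛ_)
open import Data.Fin.Subset.Properties using (p⊂q⇒∣p∣<∣q∣)
open import Data.List using (List; []; _∷_; allFin)
open import Data.List.Membership.Propositional using (_∈_)
open import Data.List.Membership.Propositional.Properties using (∈-allFin)
open import Data.List.Relation.Unary.Any using (here; there)
open import Data.Nat.Induction using (<-wellFounded)
import Data.Nat.Properties as ℕₚ
open import Data.Sum as Sum using (_⊎_; inj₁; inj₂; [_,_]′)
open import Data.Vec using (tabulate)
open import Data.Vec.Properties using (lookup∘tabulate; lookup⇒[]=; []=⇒lookup)
open import Function using (_∘_; flip)
open import Induction.WellFounded using (Acc; acc)
open import Relation.Binary using (Rel; Antisymmetric; tri<; tri≈; tri>)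
import Relation.Binary.Definitions as B
open import Relation.Binary.Construct.Closure.ReflexiveTransitive as Star using (Star; ε; _◅_; _◅◅_)
open import Relation.Binary.Construct.Closure.Transitive using (TransClosure; [_]; _∷_)
open import Relation.Binary.PropositionalEquality
open import Relation.Nullary using (¬_; yes; no; does; contradiction)
open import Relation.Nullary.Decidable
  using (map′; dec-true; dec-false; ¬?; _×-dec_; _⊎-dec_; _→-dec_)
open import Relation.Unary using (Pred; Decidable)

Least : {A : Set} → Rel A 0ℓ → Pred A 0ℓ → Pred A 0ℓ
Least _≼_ P x = P x × (∀ {y} → P y → x ≼ y)

least-unique : {A : Set} {_≼_ : Rel A 0ℓ} {P Q : Pred A 0ℓ} {x y : A} →
               Antisymmetric _≡_ _≼_ → Least _≼_ P x → Least _≼_ Q y → P y → Q x → x ≡ y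
least-unique antisym (_ , x≼) (_ , y≼) Py Qx = antisym (x≼ Py) (y≼ Qx)

ℕ-least : {P : Pred ℕ 0ℓ} → Decidable P → ∀ {m} → P m → ∃ (Least _≤_ P)
ℕ-least P? {zero} P0 = zero , P0 , λ _ → z≤n
ℕ-least P? {suc m} Pm with P? zero
... | yes P0 = zero , P0 , λ _ → z≤n
... | no ¬P0 = let k , Pk , k≤ = ℕ-least (P? ∘ suc) Pm in
  suc k , Pk , λ { {zero} P0 → contradiction P0 ¬P0 ; {suc j} Pj → s≤s (k≤ Pj) }

fin-least : ∀ {n} {P : Pred (Fin n) 0ℓ} → Decidable P → ∀ {x} → P x → ∃ (Least Fin._≤_ P)
fin-least P? {zero} P0 = zero , P0 , λ _ → z≤n
fin-least P? {suc x} Px with P? zero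
... | yes P0 = zero , P0 , λ _ → z≤n
... | no ¬P0 = let k , Pk , k≤ = fin-least (P? ∘ suc) Px in
  suc k , Pk , λ { {zero} P0 → contradiction P0 ¬P0 ; {suc j} Pj → s≤s (k≤ Pj) }

fin-least? : ∀ {n} {P : Pred (Fin n) 0ℓ} → Decidable P → Decidable (Least Fin._≤_ P)
fin-least? P? x = P? x ×-dec map′ (λ least {y} → least y) (λ least y → least)
                                  (Finₚ.all? λ y → P? y →-dec x Finₚ.≤? y)

module _ {n} {P : Pred (Fin n) 0ℓ} (P? : Decidable P) where

  subset : Subset n
  subset = tabulate (does ∘ P?)

  ∈-subset⁺ : ∀ {x} → P x → x ∈ₛ subset
  ∈-subset⁺ {x} Px =
    lookup⇒[]= x subset (trans (lookup∘tabulate (does ∘ P?) x) (dec-true (P? x) Px))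

  ∈-subset⁻ : ∀ {x} → x ∈ₛ subset → P x
  ∈-subset⁻ {x} x∈ with P? x | trans (sym (lookup∘tabulate (does ∘ P?) x)) ([]=⇒lookup x∈)
  ... | yes Px | _  = Px
  ... | no  _  | ()

∣subset∣-mono-< : ∀ {n} {P Q : Pred (Fin n) 0ℓ} (P? : Decidable P) (Q? : Decidable Q) →
                  (∀ {x} → P x → Q x) → ∀ {x} → Q x → ¬ P x →
                  ∣ subset P? ∣ < ∣ subset Q? ∣
∣subset∣-mono-< P? Q? P⇒Q {x} Qx ¬Px =
  p⊂q⇒∣p∣<∣q∣ (∈-subset⁺ Q? ∘ P⇒Q ∘ ∈-subset⁻ P? , x , ∈-subset⁺ Q? Qx , ¬Px ∘ ∈-subset⁻ P?)

module _ {n} {P : Pred (Fin n) 0ℓ} (P? : Decidable P) where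

  private
    below? : (x : Fin n) → Decidable (λ y → P y × y Fin.< x)
    below? x y = P? y ×-dec y Finₚ.<? x

  rank : Fin n → ℕ
  rank x = ∣ subset (below? x) ∣

  rank<∣subset∣ : ∀ {x} → P x → rank x < ∣ subset P? ∣
  rank<∣subset∣ {x} Px =
    ∣subset∣-mono-< (below? x) P? proj₁ Px λ (_ , x<x) → Finₚ.<-irrefl refl x<x

  rank-mono-< : ∀ {x y} → P x → x Fin.< y → rank x < rank y
  rank-mono-< {x} {y} Px x<y = ∣subset∣-mono-< (below? x) (below? y)
    (λ (Pz , z<x) → Pz , Finₚ.<-trans z<x x<y) (Px , x<y) λ (_ , x<x) → Finₚ.<-irrefl refl x<x

  rank-injective : ∀ {x y} → P x → P y → rank x ≡ rank y → x ≡ y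
  rank-injective {x} {y} Px Py eq with Finₚ.<-cmp x y
  ... | tri< x<y _ _ = contradiction eq (ℕₚ.<⇒≢ (rank-mono-< Px x<y))
  ... | tri≈ _ x≡y _ = x≡y
  ... | tri> _ _ y<x = contradiction (sym eq) (ℕₚ.<⇒≢ (rank-mono-< Py y<x))

module _ {n} {A : Set} (f : Fin n → Fin n → A) where

  symmetrise : Fin n → Fin n → A
  symmetrise u v with u Finₚ.≤? v
  ... | yes _ = f u v
  ... | no  _ = f v u

  symmetrise-comm : ∀ u v → symmetrise u v ≡ symmetrise v u
  symmetrise-comm u v with u Finₚ.≤? v | v Finₚ.≤? u
  ... | yes u≤v | yes v≤u rewrite Finₚ.≤-antisym u≤v v≤u = refl
  ... | yes _   | no  _   = refl
  ... | no  _   | yes _   = refl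
  ... | no  u≰v | no  v≰u = contradiction (Finₚ.≤-total u v) [ u≰v , v≰u ]′

  symmetrise-cases : ∀ u v → symmetrise u v ≡ f u v ⊎ symmetrise u v ≡ f v u
  symmetrise-cases u v with u Finₚ.≤? v
  ... | yes _ = inj₁ refl
  ... | no  _ = inj₂ refl

m≤1+n⇒m≤n⊎m≡1+n : ∀ {m n} → m ≤ suc n → m ≤ n ⊎ m ≡ suc n
m≤1+n⇒m≤n⊎m≡1+n = Sum.map₁ s≤s⁻¹ ∘ ℕₚ.m≤n⇒m<n∨m≡n

argmax-upTo : (h : ℕ → ℕ) (M : ℕ) → ∃ λ k → k ≤ M × (∀ {j} → j ≤ M → h j ≤ h k)
argmax-upTo h zero = zero , z≤n , λ { z≤n → ℕₚ.≤-refl }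
argmax-upTo h (suc M) with argmax-upTo h M
... | k , k≤M , k-max with ℕₚ.≤-total (h (suc M)) (h k)
...   | inj₁ ≤k = k , ℕₚ.m≤n⇒m≤1+n k≤M ,
                  [ k-max , (λ { refl → ≤k }) ]′ ∘ m≤1+n⇒m≤n⊎m≡1+n
...   | inj₂ k≤ = suc M , ℕₚ.≤-refl ,
                  [ (λ j≤M → ℕₚ.≤-trans (k-max j≤M) k≤) , (λ { refl → ℕₚ.≤-refl }) ]′
                  ∘ m≤1+n⇒m≤n⊎m≡1+n

clamp : (N : ℕ) → ℕ → Fin (suc N)
clamp N       zero    = zero
clamp zero    (suc k) = zero
clamp (suc N) (suc k) = suc (clamp N k)

toℕ-clamp : ∀ {N k} → k ≤ N → toℕ (clamp N k) ≡ k
toℕ-clamp {N}     {zero}  _         = refl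
toℕ-clamp {suc N} {suc k} (s≤s k≤N) = cong suc (toℕ-clamp k≤N)

cycle⇒closed-sequence : ∀ {n} {E : Rel (Fin n) 0ℓ} → HasCycle E →
  ∃₂ λ M (g : ℕ → Fin n) → 2 ≤ M
    × (∀ {i j} → i ≤ M → j ≤ M → g i ≡ g j → i ≡ j)
    × (∀ {k} → k < M → E (g k) (g (suc k)))
    × E (g M) (g 0)
cycle⇒closed-sequence {E = E} (m , f , f-injective , step , closing) =
  M , f ∘ clamp M , s≤s (s≤s z≤n) , injective , step′ , closing′
  where
    M = suc (suc m)

    injective : ∀ {i j} → i ≤ M → j ≤ M → f (clamp M i) ≡ f (clamp M j) → i ≡ j
    injective {i} {j} i≤M j≤M eq = begin
      i                ≡⟨ toℕ-clamp i≤M ⟨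
      toℕ (clamp M i)  ≡⟨ cong toℕ (f-injective eq) ⟩
      toℕ (clamp M j)  ≡⟨ toℕ-clamp j≤M ⟩
      j                ∎
      where open ≡-Reasoning

    step′ : ∀ {k} → k < M → E (f (clamp M k)) (f (clamp M (suc k)))
    step′ {k} k<M = subst₂ (λ a b → E (f a) (f b))
                           (Finₚ.toℕ-injective this) (Finₚ.toℕ-injective next) (step (fromℕ< k<M))
      where
        this : toℕ (inject₁ (fromℕ< k<M)) ≡ toℕ (clamp M k)
        this = trans (Finₚ.toℕ-inject₁ _)
                     (trans (Finₚ.toℕ-fromℕ< k<M) (sym (toℕ-clamp (ℕₚ.<⇒≤ k<M))))

        next : toℕ (suc (fromℕ< k<M)) ≡ toℕ (clamp M (suc k))
        next = trans (cong suc (Finₚ.toℕ-fromℕ< k<M)) (sym (toℕ-clamp k<M))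

    closing′ : E (f (clamp M M)) (f zero)
    closing′ = subst (λ a → E (f a) (f zero))
                     (Finₚ.toℕ-injective (trans (Finₚ.toℕ-fromℕ M) (sym (toℕ-clamp ℕₚ.≤-refl))))
                     closing

module _ {n} {E Parent : Rel (Fin n) 0ℓ} (height : Fin n → ℕ)
         (oriented : ∀ {u v} → E u v → Parent u v ⊎ Parent v u)
         (parent-unique : ∀ {p q v} → Parent p v → Parent q v → p ≡ q)
         (parent-lower : ∀ {p v} → Parent p v → height p < height v) where

  private
    Adjacent : Rel (Fin n) 0ℓ
    Adjacent u v = E u v ⊎ E v u

    lower-neighbour⇒parent : ∀ {u v} → Adjacent u v → height u ≤ height v → Parent u v
    lower-neighbour⇒parent uv hu≤hv with [ oriented , Sum.swap ∘ oriented ]′ uv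
    ... | inj₁ parent = parent
    ... | inj₂ child  = contradiction hu≤hv (ℕₚ.<⇒≱ (parent-lower child))

    no-peak : ∀ {u w v} → Adjacent u v → Adjacent w v → u ≢ w →
              height u ≤ height v → height w ≤ height v → ⊥
    no-peak uv wv u≢w hu hw =
      u≢w (parent-unique (lower-neighbour⇒parent uv hu) (lower-neighbour⇒parent wv hw))

  -- The highest vertex of a cycle would have both cycle neighbours as parents.
  parents⇒forest : Forest E
  parents⇒forest cycle with cycle⇒closed-sequence {E = E} cycle
  ... | M , g , 2≤M , injective , step , closing with argmax-upTo (height ∘ g) M
  ... | k , k≤M , highest = peak k k≤M highest
    where
      distinct : ∀ {i j} → i ≤ M → j ≤ M → i ≢ j → g i ≢ g j
      distinct i≤M j≤M i≢j = i≢j ∘ injective i≤M j≤M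

      peak : ∀ k → k ≤ M → (∀ {j} → j ≤ M → height (g j) ≤ height (g k)) → ⊥
      peak zero _ highest =
        no-peak (inj₂ (step 1≤M)) (inj₁ closing) (distinct 1≤M ℕₚ.≤-refl (ℕₚ.<⇒≢ 2≤M))
                (highest 1≤M) (highest ℕₚ.≤-refl)
        where 1≤M = ℕₚ.<⇒≤ 2≤M
      peak (suc j) 1+j≤M highest with ℕₚ.m≤n⇒m<n∨m≡n 1+j≤M
      ... | inj₁ 1+j<M =
        no-peak (inj₁ (step (ℕₚ.<⇒≤ 1+j<M))) (inj₂ (step 1+j<M))
                (distinct j≤M 1+j<M (ℕₚ.<⇒≢ (ℕₚ.m<n⇒m<1+n (ℕₚ.n<1+n j))))
                (highest j≤M) (highest 1+j<M)
        where j≤M = ℕₚ.<⇒≤ (ℕₚ.<⇒≤ 1+j<M)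
      ... | inj₂ refl =
        no-peak (inj₁ (step ℕₚ.≤-refl)) (inj₂ closing)
                (distinct (ℕₚ.n≤1+n j) z≤n (ℕₚ.<⇒≢ (s≤s⁻¹ 2≤M) ∘ sym))
                (highest (ℕₚ.n≤1+n j)) (highest z≤n)

reverse : ∀ {n} → Digraph n → Digraph n
reverse G = record { adj = flip (adj G) ; loopless = loopless G }

module _ {n} {G : Digraph n} where

  reverse-walk⁺ : ∀ {u v} → Star (Arc G) u v → Star (Arc (reverse G)) v u
  reverse-walk⁺ = Star.reverse λ e → e

  reverse-walk⁻ : ∀ {u v} → Star (Arc (reverse G)) u v → Star (Arc G) v u
  reverse-walk⁻ = Star.reverse λ e → e

module _ {n} {R : Rel (Fin n) 0ℓ} (R? : B.Decidable R) (irreflexive : ∀ {v} → ¬ R v v) where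

  digraph : Digraph n
  digraph = record
    { adj      = λ u v → does (R? u v)
    ; loopless = λ v → dec-false (R? v v) irreflexive
    }

  digraph-arc⁺ : ∀ {u v} → R u v → Arc digraph u v
  digraph-arc⁺ {u} {v} = dec-true (R? u v)

  digraph-arc⁻ : ∀ {u v} → Arc digraph u v → R u v
  digraph-arc⁻ {u} {v} e with R? u v | e
  ... | yes r | _ = r
  ... | no  _ | ()

module _ {A : Set} {R : Rel A 0ℓ} where

  ⁺⇒⋆ : ∀ {a b} → TransClosure R a b → Star R a b
  ⁺⇒⋆ [ r ]    = r ◅ ε
  ⁺⇒⋆ (r ∷ rs) = r ◅ ⁺⇒⋆ rs

  ⋆⇒⁺ : ∀ {a b} → a ≢ b → Star R a b → TransClosure R a b
  ⋆⇒⁺ a≢b ε        = contradiction refl a≢b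
  ⋆⇒⁺ _   (r ◅ rs) = go r rs
    where
      go : ∀ {a b c} → R a b → Star R b c → TransClosure R a c
      go r ε        = [ r ]
      go r (s ◅ ss) = r ∷ go s ss

same-reachability⇒SameClosure : ∀ {n} {G H : Digraph n} →
  (∀ {u v} → Star (Arc G) u v → Star (Arc H) u v) →
  (∀ {u v} → Star (Arc H) u v → Star (Arc G) u v) → SameClosure G H
same-reachability⇒SameClosure G⇒H H⇒G u v =
    (λ (u≢v , r) → u≢v , ⋆⇒⁺ u≢v (G⇒H (⁺⇒⋆ r)))
  , (λ (u≢v , r) → u≢v , ⋆⇒⁺ u≢v (H⇒G (⁺⇒⋆ r)))

module Reachability {n} (G : Digraph n) where

  infix 4 _⇝_ _≈_ _⇝?_ _≈?_

  arc? : B.Decidable (Arc G)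
  arc? u v = adj G u v ≟ᵇ true

  arc⇒≢ : ∀ {u v} → Arc G u v → u ≢ v
  arc⇒≢ {u} e refl = contradiction (trans (sym e) (loopless G u)) λ ()

  _⇝_ : Rel (Fin n) 0ℓ
  _⇝_ = Star (Arc G)

  data Through (S : List (Fin n)) : Rel (Fin n) 0ℓ where
    done : ∀ {a} → Through S a a
    last : ∀ {a b} → Arc G a b → Through S a b
    step : ∀ {a x b} → Arc G a x → x ∈ S → Through S x b → Through S a b

  through-first : ∀ {p ps a b} → Through (p ∷ ps) a b → Through ps a b ⊎ Through ps a p
  through-first done                   = inj₁ done
  through-first (last e)               = inj₁ (last e)
  through-first (step e (here refl) _) = inj₂ (last e)
  through-first (step e (there x∈) w)  = Sum.map (step e x∈) (step e x∈) (through-first w)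

  through-last : ∀ {p ps a b} → Through (p ∷ ps) a b → Through ps a b ⊎ Through ps p b
  through-last done     = inj₁ done
  through-last (last e) = inj₁ (last e)
  through-last (step e x∈ w) with through-last w | x∈
  ... | inj₂ w′ | _         = inj₂ w′
  ... | inj₁ w′ | here refl = inj₂ w′
  ... | inj₁ w′ | there x∈′ = inj₁ (step e x∈′ w′)

  -- Floyd–Warshall: once p may be an intermediate vertex, a walk splits at its first and last
  -- visit to p.
  ReachVia : List (Fin n) → Rel (Fin n) 0ℓ
  ReachVia []       a b = a ≡ b ⊎ Arc G a b
  ReachVia (p ∷ ps) a b = ReachVia ps a b ⊎ (ReachVia ps a p × ReachVia ps p b)

  reachVia? : ∀ ps → B.Decidable (ReachVia ps)
  reachVia? []       a b = a Finₚ.≟ b ⊎-dec arc? a b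
  reachVia? (p ∷ ps) a b = reachVia? ps a b ⊎-dec (reachVia? ps a p ×-dec reachVia? ps p b)

  reachVia⇒⇝ : ∀ ps {a b} → ReachVia ps a b → a ⇝ b
  reachVia⇒⇝ []       (inj₁ refl)    = ε
  reachVia⇒⇝ []       (inj₂ e)       = e ◅ ε
  reachVia⇒⇝ (p ∷ ps) (inj₁ r)       = reachVia⇒⇝ ps r
  reachVia⇒⇝ (p ∷ ps) (inj₂ (r , s)) = reachVia⇒⇝ ps r ◅◅ reachVia⇒⇝ ps s

  through⇒reachVia : ∀ ps {a b} → Through ps a b → ReachVia ps a b
  through⇒reachVia []       done         = inj₁ refl
  through⇒reachVia []       (last e)     = inj₂ e
  through⇒reachVia []       (step _ () _)
  through⇒reachVia (p ∷ ps) w with through-first w | through-last w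
  ... | inj₁ w′ | _       = inj₁ (through⇒reachVia ps w′)
  ... | inj₂ _  | inj₁ w′ = inj₁ (through⇒reachVia ps w′)
  ... | inj₂ w₁ | inj₂ w₂ = inj₂ (through⇒reachVia ps w₁ , through⇒reachVia ps w₂)

  ⇝⇒through : ∀ {a b} → a ⇝ b → Through (allFin n) a b
  ⇝⇒through ε       = done
  ⇝⇒through (e ◅ w) = step e (∈-allFin _) (⇝⇒through w)

  _⇝?_ : B.Decidable _⇝_
  a ⇝? b = map′ (reachVia⇒⇝ (allFin n)) (through⇒reachVia (allFin n) ∘ ⇝⇒through)
                (reachVia? (allFin n) a b)

  _≈_ : Rel (Fin n) 0ℓ
  a ≈ b = a ⇝ b × b ⇝ a

  ≈-refl : ∀ {a} → a ≈ a
  ≈-refl = ε , ε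

  ≈-sym : ∀ {a b} → a ≈ b → b ≈ a
  ≈-sym (a⇝b , b⇝a) = b⇝a , a⇝b

  ≈-trans : ∀ {a b c} → a ≈ b → b ≈ c → a ≈ c
  ≈-trans (a⇝b , b⇝a) (b⇝c , c⇝b) = a⇝b ◅◅ b⇝c , c⇝b ◅◅ b⇝a

  _≈?_ : B.Decidable _≈_
  a ≈? b = a ⇝? b ×-dec b ⇝? a

  root : Fin n → Fin n
  root v = proj₁ (fin-least (_≈? v) (≈-refl {v}))

  root-least : ∀ v → Least Fin._≤_ (_≈ v) (root v)
  root-least v = proj₂ (fin-least (_≈? v) (≈-refl {v}))

  root-≈ : ∀ v → root v ≈ v
  root-≈ v = proj₁ (root-least v)

  root-cong : ∀ {u v} → u ≈ v → root u ≡ root v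
  root-cong {u} {v} u≈v = least-unique Finₚ.≤-antisym (root-least u) (root-least v)
    (≈-trans (root-≈ v) (≈-sym u≈v)) (≈-trans (root-≈ u) u≈v)

  Exactly : ℕ → Rel (Fin n) 0ℓ
  Exactly zero    a b = a ≡ b
  Exactly (suc k) a b = ∃ λ x → Arc G a x × Exactly k x b

  exactly? : ∀ k → B.Decidable (Exactly k)
  exactly? zero    a b = a Finₚ.≟ b
  exactly? (suc k) a b = Finₚ.any? λ x → arc? a x ×-dec exactly? k x b

  exactly⇒⇝ : ∀ k {a b} → Exactly k a b → a ⇝ b
  exactly⇒⇝ zero    refl        = ε
  exactly⇒⇝ (suc k) (_ , e , w) = e ◅ exactly⇒⇝ k w

  ⇝⇒exactly : ∀ {a b} → a ⇝ b → ∃ λ k → Exactly k a b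
  ⇝⇒exactly ε       = zero , refl
  ⇝⇒exactly (e ◅ w) = let k , w′ = ⇝⇒exactly w in suc k , _ , e , w′

  exactly-last : ∀ k {a b} → Exactly (suc k) a b → ∃ λ w → Exactly k a w × Arc G w b
  exactly-last zero    (_ , e , refl) = _ , refl , e
  exactly-last (suc k) (x , e , w)    =
    let y , w′ , e′ = exactly-last k w in y , (x , e , w′) , e′

  module Branching (ρ : Fin n → Fin n) (ρ⇝ : ∀ v → ρ v ⇝ v)
                   (ρ-stable : ∀ {u v} → ρ v ⇝ u → u ⇝ v → ρ u ≡ ρ v) where

    dist : Fin n → ℕ
    dist v = proj₁ (ℕ-least (λ k → exactly? k (ρ v) v) (proj₂ (⇝⇒exactly (ρ⇝ v))))

    dist-least : ∀ v → Least _≤_ (λ k → Exactly k (ρ v) v) (dist v)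
    dist-least v = proj₂ (ℕ-least (λ k → exactly? k (ρ v) v) (proj₂ (⇝⇒exactly (ρ⇝ v))))

    Parent : Rel (Fin n) 0ℓ
    Parent p v = Least Fin._≤_ (λ w → Exactly (pred (dist v)) (ρ v) w × Arc G w v) p

    parent? : B.Decidable Parent
    parent? p v = fin-least? (λ w → exactly? (pred (dist v)) (ρ v) w ×-dec arc? w v) p

    parent-arc : ∀ {p v} → Parent p v → Arc G p v
    parent-arc ((_ , e) , _) = e

    parent-unique : ∀ {p q v} → Parent p v → Parent q v → p ≡ q
    parent-unique par par′ = least-unique Finₚ.≤-antisym par par′ (proj₁ par′) (proj₁ par)

    parent-root : ∀ {p v} → Parent p v → ρ p ≡ ρ v
    parent-root ((walk , e) , _) = ρ-stable (exactly⇒⇝ _ walk) (e ◅ ε)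

    parent-exists : ∀ {v} → v ≢ ρ v → ∃ λ p → Parent p v
    parent-exists {v} v≢ρv =
      fin-least (λ w → exactly? (pred (dist v)) (ρ v) w ×-dec arc? w v)
                (proj₂ (last-arc (dist v) (proj₁ (dist-least v))))
      where
        last-arc : ∀ k → Exactly k (ρ v) v → ∃ λ w → Exactly (pred k) (ρ v) w × Arc G w v
        last-arc zero    ρv≡v = contradiction (sym ρv≡v) v≢ρv
        last-arc (suc k) walk = exactly-last k walk

    parent-lower : ∀ {p v} → Parent p v → dist p < dist v
    parent-lower {p} {v} par@((walk , e) , _) =
      ℕₚ.≤-<-trans dist-p≤ (pred< (dist v) (proj₁ (dist-least v)) walk)
      where
        dist-p≤ : dist p ≤ pred (dist v)
        dist-p≤ = proj₂ (dist-least p)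
                        (subst (λ r → Exactly (pred (dist v)) r p) (sym (parent-root par)) walk)

        pred< : ∀ k → Exactly k (ρ v) v → Exactly (pred k) (ρ v) p → pred k < k
        pred< zero    ρv≡v ρv≡p = contradiction (trans (sym ρv≡p) ρv≡v) (arc⇒≢ e)
        pred< (suc k) _    _    = ℕₚ.n<1+n k

    tree-path : ∀ v → Star Parent (ρ v) v
    tree-path v = go v (<-wellFounded (dist v))
      where
        go : ∀ v → Acc _<_ (dist v) → Star Parent (ρ v) v
        go v (acc smaller) with v Finₚ.≟ ρ v
        ... | yes v≡ρv = subst (Star Parent (ρ v)) (sym v≡ρv) ε
        ... | no  v≢ρv =
          let p , par = parent-exists v≢ρv
          in subst (λ r → Star Parent r p) (parent-root par) (go p (smaller (parent-lower par)))
             ◅◅ par ◅ ε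

module Covering {n} (G : Digraph n) where
  open Reachability G

  StrictlyBetween : Fin n → Fin n → Pred (Fin n) 0ℓ
  StrictlyBetween a b w = (a ⇝ w × w ⇝ b) × ¬ w ≈ a × ¬ w ≈ b

  strictlyBetween? : ∀ a b → Decidable (StrictlyBetween a b)
  strictlyBetween? a b w = (a ⇝? w ×-dec w ⇝? b) ×-dec ¬? (w ≈? a) ×-dec ¬? (w ≈? b)

  Covers : Rel (Fin n) 0ℓ
  Covers x y = Arc G x y × ¬ y ⇝ x × ¬ ∃ (StrictlyBetween x y)

  covers? : B.Decidable Covers
  covers? x y = arc? x y ×-dec ¬? (y ⇝? x) ×-dec ¬? (Finₚ.any? (strictlyBetween? x y))

  Chosen : Rel (Fin n) 0ℓ
  Chosen x y = Least Fin._≤_ (λ x′ → x′ ≈ x × Covers x′ y) x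

  chosen? : B.Decidable Chosen
  chosen? x y = fin-least? (λ x′ → x′ ≈? x ×-dec covers? x′ y) x

  chosen⇒covers : ∀ {x y} → Chosen x y → Covers x y
  chosen⇒covers ((_ , covers) , _) = covers

  chosen-exists : ∀ {x y} → Covers x y → ∃ λ x* → x* ≈ x × Chosen x* y
  chosen-exists {x} {y} covers =
    let x* , (x*≈x , covers*) , least =
          fin-least (λ x′ → x′ ≈? x ×-dec covers? x′ y) (≈-refl , covers)
    in x* , x*≈x , (≈-refl , covers*) ,
       λ (x′≈x* , covers′) → least (≈-trans x′≈x* x*≈x , covers′)

  chosen-incomparable : ∀ {x₁ x₂ y} → Chosen x₁ y → Chosen x₂ y → x₁ ⇝ x₂ → x₁ ≡ x₂
  chosen-incomparable {x₁} {x₂} ((_ , covers₁) , least₁) ((_ , covers₂) , least₂) x₁⇝x₂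
    with x₂ ≈? x₁
  ... | yes x₂≈x₁ = Finₚ.≤-antisym (least₁ (x₂≈x₁ , covers₂)) (least₂ (≈-sym x₂≈x₁ , covers₁))
  ... | no  x₂≉x₁ =
    let e₂ , y⇝̸x₂ , _ = covers₂ in
    contradiction (x₂ , (x₁⇝x₂ , e₂ ◅ ε) , x₂≉x₁ , y⇝̸x₂ ∘ proj₂) (proj₂ (proj₂ covers₁))

  covers⇒ancestors< : ∀ {x y} → Covers x y → ∣ subset (_⇝? x) ∣ < ∣ subset (_⇝? y) ∣
  covers⇒ancestors< (e , y⇝̸x , _) =
    ∣subset∣-mono-< (_⇝? _) (_⇝? _) (λ w⇝x → w⇝x ◅◅ e ◅ ε) ε y⇝̸x

  covering-arc : ∀ {a b} → a ⇝ b → ¬ a ≈ b → ¬ ∃ (StrictlyBetween a b) →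
                 ∃₂ λ x y → x ≈ a × y ≈ b × Covers x y
  covering-arc {a} {b} a⇝b a≉b nothing-between =
    let x , y , x≈a , y≈b , e = crossing ≈-refl a⇝b in
    x , y , x≈a , y≈b , e
      , (λ y⇝x → a≉b (a⇝b , proj₂ y≈b ◅◅ y⇝x ◅◅ proj₁ x≈a))
      , λ (w , (x⇝w , w⇝y) , w≉x , w≉y) →
          [ w≉x ∘ flip ≈-trans (≈-sym x≈a) , w≉y ∘ flip ≈-trans (≈-sym y≈b) ]′
            (class-of (proj₂ x≈a ◅◅ x⇝w) (w⇝y ◅◅ proj₁ y≈b))
    where
      class-of : ∀ {w} → a ⇝ w → w ⇝ b → w ≈ a ⊎ w ≈ b
      class-of {w} a⇝w w⇝b with w ≈? a | w ≈? b
      ... | yes w≈a | _       = inj₁ w≈a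
      ... | no  _   | yes w≈b = inj₂ w≈b
      ... | no  w≉a | no  w≉b = contradiction (w , (a⇝w , w⇝b) , w≉a , w≉b) nothing-between

      crossing : ∀ {z} → z ≈ a → z ⇝ b → ∃₂ λ x y → x ≈ a × y ≈ b × Arc G x y
      crossing z≈a ε = contradiction (≈-sym z≈a) a≉b
      crossing {z} z≈a (e ◅ w) with class-of (proj₂ z≈a ◅◅ e ◅ ε) w
      ... | inj₁ z′≈a = crossing z′≈a w
      ... | inj₂ z′≈b = z , _ , z≈a , z′≈b , e

  module _ {R : Rel (Fin n) 0ℓ} (within-class : ∀ {a b} → a ≈ b → Star R a b)
           (chosen : ∀ {x y} → Chosen x y → R x y) where

    private
      between? : ∀ a b → Decidable (λ w → a ⇝ w × w ⇝ b)
      between? a b w = a ⇝? w ×-dec w ⇝? b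

      interval : Fin n → Fin n → ℕ
      interval a b = ∣ subset (between? a b) ∣

      interval-left< : ∀ {a w b} → a ⇝ b → w ⇝ b → ¬ w ≈ b → interval a w < interval a b
      interval-left< a⇝b w⇝b w≉b = ∣subset∣-mono-< (between? _ _) (between? _ _)
        (λ (a⇝z , z⇝w) → a⇝z , z⇝w ◅◅ w⇝b) (a⇝b , ε) (λ (_ , b⇝w) → w≉b (w⇝b , b⇝w))

      interval-right< : ∀ {a w b} → a ⇝ b → a ⇝ w → ¬ w ≈ a → interval w b < interval a b
      interval-right< a⇝b a⇝w w≉a = ∣subset∣-mono-< (between? _ _) (between? _ _)
        (λ (w⇝z , z⇝b) → a⇝w ◅◅ w⇝z , z⇝b) (ε , a⇝b) (λ (w⇝a , _) → w≉a (w⇝a , a⇝w))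

    reach-via-chosen : ∀ {a b} → a ⇝ b → Star R a b
    reach-via-chosen {a} {b} = go (<-wellFounded (interval a b))
      where
        go : ∀ {a b} → Acc _<_ (interval a b) → a ⇝ b → Star R a b
        go {a} {b} (acc smaller) a⇝b with a ≈? b | Finₚ.any? (strictlyBetween? a b)
        ... | yes a≈b | _ = within-class a≈b
        ... | no _    | yes (w , (a⇝w , w⇝b) , w≉a , w≉b) =
          go (smaller (interval-left< a⇝b w⇝b w≉b)) a⇝w
          ◅◅ go (smaller (interval-right< a⇝b a⇝w w≉a)) w⇝b
        ... | no a≉b  | no nothing-between =
          let x , y , x≈a , y≈b , covers = covering-arc a⇝b a≉b nothing-between
              x* , x*≈x , chosen* = chosen-exists covers
          in within-class (≈-sym (≈-trans x*≈x x≈a)) ◅◅ chosen chosen* ◅ within-class y≈b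

incomparable⇒independent : ∀ {n} {G′ G : Digraph n} {S : Subset n} → SameClosure G′ G →
  (∀ {u v} → u ∈ₛ S → v ∈ₛ S → Reachability._⇝_ G u v → u ≡ v) → Independent G′ S
incomparable⇒independent {G′ = G′} {S = S} same incomparable u v u∈S v∈S =
  [ no-arc u∈S v∈S , no-arc v∈S u∈S ]′
  where
    no-arc : ∀ {u v} → u ∈ₛ S → v ∈ₛ S → ¬ Arc G′ u v
    no-arc {u} {v} u∈S v∈S e =
      let u≢v = Reachability.arc⇒≢ G′ e in
      u≢v (incomparable u∈S v∈S (⁺⇒⋆ (proj₂ (proj₁ (same u v) (u≢v , [ e ])))))

module Spanner {n} (G : Digraph n) where
  open Reachability G
  open Covering G

  module Out = Branching root (proj₁ ∘ root-≈)
    (λ ρv⇝u u⇝v → root-cong (u⇝v , proj₂ (root-≈ _) ◅◅ ρv⇝u))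
  module In = Reachability.Branching (reverse G) root (reverse-walk⁺ {G = G} ∘ proj₂ ∘ root-≈)
    (λ ρv⇜u u⇜v → root-cong ( reverse-walk⁻ {G = G} ρv⇜u ◅◅ proj₁ (root-≈ _)
                            , reverse-walk⁻ {G = G} u⇜v))

  HArc : Rel (Fin n) 0ℓ
  HArc u v = Chosen u v ⊎ Out.Parent u v ⊎ In.Parent v u

  harc? : B.Decidable HArc
  harc? u v = chosen? u v ⊎-dec Out.parent? u v ⊎-dec In.parent? v u

  harc⇒arc : ∀ {u v} → HArc u v → Arc G u v
  harc⇒arc (inj₁ c)         = proj₁ (chosen⇒covers c)
  harc⇒arc (inj₂ (inj₁ p))  = Out.parent-arc p
  harc⇒arc (inj₂ (inj₂ p))  = In.parent-arc p

  harc-irreflexive : ∀ {v} → ¬ HArc v v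
  harc-irreflexive h = arc⇒≢ (harc⇒arc h) refl

  H : Digraph n
  H = digraph harc? harc-irreflexive

  harc⁺ : ∀ {u v} → HArc u v → Arc H u v
  harc⁺ = digraph-arc⁺ harc? harc-irreflexive

  harc⁻ : ∀ {u v} → Arc H u v → HArc u v
  harc⁻ = digraph-arc⁻ harc? harc-irreflexive

  H⊆G : Subgraph H G
  H⊆G u v = harc⇒arc ∘ harc⁻

  within-class : ∀ {a b} → a ≈ b → Star (Arc H) a b
  within-class {a} {b} a≈b =
    to-root ◅◅ subst (λ r → Star (Arc H) r b) (sym (root-cong a≈b)) from-root
    where
      to-root : Star (Arc H) a (root a)
      to-root = Star.reverse (λ p → harc⁺ (inj₂ (inj₂ p))) (In.tree-path a)

      from-root : Star (Arc H) (root b) b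
      from-root = Star.map (λ p → harc⁺ (inj₂ (inj₁ p))) (Out.tree-path b)

  same-closure : SameClosure H G
  same-closure = same-reachability⇒SameClosure {G = H} {H = G}
    (Star.map (λ {u} {v} → H⊆G u v)) (reach-via-chosen within-class (harc⁺ ∘ inj₁))

  chosen-bound : ∀ {G′ α} → SameClosure G′ G → IsIndependenceNumber G′ α →
                 ∀ y → ∣ subset (flip chosen? y) ∣ ≤ α
  chosen-bound {G′} same (_ , maximal) y =
    maximal (subset (flip chosen? y)) (incomparable⇒independent {G′ = G′} {G = G} same λ u∈S v∈S →
      chosen-incomparable (∈-subset⁻ (flip chosen? y) u∈S) (∈-subset⁻ (flip chosen? y) v∈S))

  module Colouring (α : ℕ) (bound : ∀ y → ∣ subset (flip chosen? y) ∣ ≤ α) where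

    rank-colour : ∀ {x y} → Chosen x y → Fin α
    rank-colour {x} {y} c = fromℕ< (ℕₚ.<-≤-trans (rank<∣subset∣ (flip chosen? y) c) (bound y))

    colour : Fin n → Fin n → Fin α ⊎ Fin 2
    colour u v with chosen? u v | chosen? v u | Out.parent? u v ⊎-dec Out.parent? v u
    ... | yes c | _     | _     = inj₁ (rank-colour c)
    ... | no _  | yes c | _     = inj₁ (rank-colour c)
    ... | no _  | no _  | yes _ = inj₂ zero
    ... | no _  | no _  | no _  = inj₂ (suc zero)

    ColourParent : Fin α ⊎ Fin 2 → Rel (Fin n) 0ℓ
    ColourParent (inj₁ i)       p v = Chosen p v × rank (flip chosen? v) p ≡ toℕ i
    ColourParent (inj₂ zero)        = Out.Parent
    ColourParent (inj₂ (suc _))     = In.Parent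

    height : Fin α ⊎ Fin 2 → Fin n → ℕ
    height (inj₁ _)       v = ∣ subset (_⇝? v) ∣
    height (inj₂ zero)      = Out.dist
    height (inj₂ (suc _))   = In.dist

    colour-parent : ∀ {k} u v → colour u v ≡ k → HArc u v ⊎ HArc v u →
                    ColourParent k u v ⊎ ColourParent k v u
    colour-parent u v refl uv with chosen? u v | chosen? v u | Out.parent? u v ⊎-dec Out.parent? v u
    ... | yes c | _     | _       = inj₁ (c , sym (Finₚ.toℕ-fromℕ< _))
    ... | no _  | yes c | _       = inj₂ (c , sym (Finₚ.toℕ-fromℕ< _))
    ... | no _  | no _  | yes out = out
    ... | no ¬c | no ¬c′ | no ¬out = in-tree uv
      where
        in-tree : HArc u v ⊎ HArc v u → In.Parent u v ⊎ In.Parent v u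
        in-tree (inj₁ (inj₁ c))        = contradiction c ¬c
        in-tree (inj₁ (inj₂ (inj₁ p))) = contradiction (inj₁ p) ¬out
        in-tree (inj₁ (inj₂ (inj₂ p))) = inj₂ p
        in-tree (inj₂ (inj₁ c))        = contradiction c ¬c′
        in-tree (inj₂ (inj₂ (inj₁ p))) = contradiction (inj₂ p) ¬out
        in-tree (inj₂ (inj₂ (inj₂ p))) = inj₁ p

    colour-parent-unique : ∀ k {p q v} → ColourParent k p v → ColourParent k q v → p ≡ q
    colour-parent-unique (inj₁ _) (c₁ , r₁) (c₂ , r₂) =
      rank-injective (flip chosen? _) c₁ c₂ (trans r₁ (sym r₂))
    colour-parent-unique (inj₂ zero)    = Out.parent-unique
    colour-parent-unique (inj₂ (suc _)) = In.parent-unique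

    colour-parent-lower : ∀ k {p v} → ColourParent k p v → height k p < height k v
    colour-parent-lower (inj₁ _) (c , _) = covers⇒ancestors< (chosen⇒covers c)
    colour-parent-lower (inj₂ zero)      = Out.parent-lower
    colour-parent-lower (inj₂ (suc _))   = In.parent-lower

    edge-colour : Fin n → Fin n → Fin (α + 2)
    edge-colour u v = join α 2 (symmetrise colour u v)

    colour-class-forest : ∀ i → Forest (λ u v → Edge H u v × edge-colour u v ≡ i)
    colour-class-forest i =
      parents⇒forest (height k) oriented (colour-parent-unique k) (colour-parent-lower k)
      where
        k = splitAt α i

        colour≡k : ∀ u v → edge-colour u v ≡ i → symmetrise colour u v ≡ k
        colour≡k u v coloured = trans (sym (Finₚ.splitAt-join α 2 _)) (cong (splitAt α) coloured)

        oriented : ∀ {u v} → Edge H u v × edge-colour u v ≡ i →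
                   ColourParent k u v ⊎ ColourParent k v u
        oriented {u} {v} (e , coloured) =
          [ (λ eq → colour-parent u v (trans (sym eq) symmetrised≡k) harcs)
          , (λ eq → Sum.swap (colour-parent v u (trans (sym eq) symmetrised≡k) (Sum.swap harcs)))
          ]′ (symmetrise-cases colour u v)
          where
            symmetrised≡k = colour≡k u v coloured
            harcs = Sum.map harc⁻ harc⁻ e

    arboricity : ArboricityAtMost H (α + 2)
    arboricity =
      edge-colour , (λ u v → cong (join α 2) (symmetrise-comm colour u v)) , colour-class-forest

lemma4p1 : (n : ℕ) (G′ G : Digraph n) (α β : ℕ)
    → SameClosure G′ G
    → IsIndependenceNumber G′ α
    → IsIndependenceNumber G β
    → α ≤ β
    → Σ (Digraph n) λ H → Subgraph H G × ArboricityAtMost H (α + 2) × SameClosure H G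
lemma4p1 n G′ G α β same independence _ _ = H , H⊆G , arboricity , same-closure
  where
    open Spanner G
    open Colouring α (chosen-bound {G′} same independence)
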